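{- Let $M$ and $N$ be terms of $\lambda{*}$ with $M = N$ (i.e. $M$ and $N$ are convertible). Then $\overline{M} = \overline{N}$ (they are convertible in $\lambda{*}U$).
   Context: $\lambda{*}$ is the "type-in-type" pure type system with $\Sigma$-types. Its raw terms are $t ::= * \mid x \mid \Pi x{:}A.B \mid \Sigma x{:}A.B \mid \lambda x{:}A.t \mid s\,t \mid (s,t) \mid \pi_1 t \mid \pi_2 t$, with the single axiom $* : *$. Equality ("$=$") of terms is untyped conversion: the congruence generated by $(\lambda x{:}A.s)\,t = s[t/x]$ and $\pi_i(t_1,t_2) = t_i$ ($i=1,2$). $\lambda{*}U$ is $\lambda{*}$ extended by an inductive–recursive universe: an inductive type $U : *$ with constructors $\hat\Pi : \Pi A{:}U.\,(TA \to U) \to U$, $\hat\Sigma : \Pi A{:}U.\,(TA\to U)\to U$, $\hat{*} : U$, defined simultaneously with $T : U \to *$ satisfying $T(\hat\Pi A B) = \Pi a{:}TA.\,T(Ba)$, $T(\hat\Sigma A B) = \Sigma a{:}TA.\,T(Ba)$, $T(\hat *) = U$ (these equations are added to conversion). The reflection map $\overline{(\cdot)}$ from raw terms of $\lambda{*}$ to raw terms of $\lambda{*}U$: $\overline{*} = \hat *$; $\overline{x} = x$; $\overline{\Pi x{:}A.B} = \hat\Pi\,\overline{A}\,(\lambda x{:}T\overline{A}.\,\overline{B})$; $\overline{\Sigma x{:}A.B} = \hat\Sigma\,\overline{A}\,(\lambda x{:}T\overline{A}.\,\overline{B})$; $\overline{\lambda x{:}A.t} = \lambda x{:}\overline{A}.\,\overline{t}$;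 $\overline{s\,t} = \overline{s}\,\overline{t}$; $\overline{(s,t)} = (\overline{s},\overline{t})$; $\overline{\pi_i s} = \pi_i \overline{s}$. -}

module Defs where

open import Data.Nat using (ℕ; zero; suc)
open import Data.Fin using (Fin; zero; suc)
open import Data.Empty using (⊥)

-- Raw terms, well-scoped de Bruijn syntax, over a set C of constants.
-- λ* terms are  Tm ⊥ n  (no constants); λ*U terms are  Tm UConst n.
data Tm (C : Set) (n : ℕ) : Set where
  star : Tm C n
  var  : Fin n → Tm C n
  Pi   : Tm C n → Tm C (suc n) → Tm C n
  Sg   : Tm C n → Tm C (suc n) → Tm C n
  lam  : Tm C n → Tm C (suc n) → Tm C n
  app  : Tm C n → Tm C n → Tm C n
  pair : Tm C n → Tm C n → Tm C n
  fst  : Tm C n → Tm C n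
  snd  : Tm C n → Tm C n
  con  : C → Tm C n

ext : ∀ {n m} → (Fin n → Fin m) → Fin (suc n) → Fin (suc m)
ext ρ zero    = zero
ext ρ (suc i) = suc (ρ i)

rename : ∀ {C n m} → (Fin n → Fin m) → Tm C n → Tm C m
rename ρ star       = star
rename ρ (var i)    = var (ρ i)
rename ρ (Pi A B)   = Pi (rename ρ A) (rename (ext ρ) B)
rename ρ (Sg A B)   = Sg (rename ρ A) (rename (ext ρ) B)
rename ρ (lam A t)  = lam (rename ρ A) (rename (ext ρ) t)
rename ρ (app s t)  = app (rename ρ s) (rename ρ t)
rename ρ (pair s t) = pair (rename ρ s) (rename ρ t)
rename ρ (fst t)    = fst (rename ρ t)
rename ρ (snd t)    = snd (rename ρ t)
rename ρ (con c)    = con c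

wk : ∀ {C n} → Tm C n → Tm C (suc n)
wk = rename suc

exts : ∀ {C n m} → (Fin n → Tm C m) → Fin (suc n) → Tm C (suc m)
exts σ zero    = var zero
exts σ (suc i) = wk (σ i)

subst : ∀ {C n m} → (Fin n → Tm C m) → Tm C n → Tm C m
subst σ star       = star
subst σ (var i)    = σ i
subst σ (Pi A B)   = Pi (subst σ A) (subst (exts σ) B)
subst σ (Sg A B)   = Sg (subst σ A) (subst (exts σ) B)
subst σ (lam A t)  = lam (subst σ A) (subst (exts σ) t)
subst σ (app s t)  = app (subst σ s) (subst σ t)
subst σ (pair s t) = pair (subst σ s) (subst σ t)
subst σ (fst t)    = fst (subst σ t)
subst σ (snd t)    = snd (subst σ t)
subst σ (con c)    = con c

sub0 : ∀ {C n} → Tm C n → Fin (suc n) → Tm C n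
sub0 t zero    = t
sub0 t (suc i) = var i

-- s [ t ]  is  s[t/x]  where x is the variable bound (de Bruijn index 0)
_[_] : ∀ {C n} → Tm C (suc n) → Tm C n → Tm C n
s [ t ] = subst (sub0 t) s

data Conv {C : Set} (R : ∀ {n} → Tm C n → Tm C n → Set)
          : ∀ {n} → Tm C n → Tm C n → Set where
  c-refl  : ∀ {n} {t : Tm C n} → Conv R t t
  c-sym   : ∀ {n} {s t : Tm C n} → Conv R s t → Conv R t s
  c-trans : ∀ {n} {s t u : Tm C n} → Conv R s t → Conv R t u → Conv R s u
  c-beta  : ∀ {n} {A : Tm C n} {s : Tm C (suc n)} {t : Tm C n} →
            Conv R (app (lam A s) t) (s [ t ])
  c-fst   : ∀ {n} {s t : Tm C n} → Conv R (fst (pair s t)) s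
  c-snd   : ∀ {n} {s t : Tm C n} → Conv R (snd (pair s t)) t
  c-rule  : ∀ {n} {s t : Tm C n} → R s t → Conv R s t
  c-Pi    : ∀ {n} {A A' : Tm C n} {B B' : Tm C (suc n)} →
            Conv R A A' → Conv R B B' → Conv R (Pi A B) (Pi A' B')
  c-Sg    : ∀ {n} {A A' : Tm C n} {B B' : Tm C (suc n)} →
            Conv R A A' → Conv R B B' → Conv R (Sg A B) (Sg A' B')
  c-lam   : ∀ {n} {A A' : Tm C n} {t t' : Tm C (suc n)} →
            Conv R A A' → Conv R t t' → Conv R (lam A t) (lam A' t')
  c-app   : ∀ {n} {s s' t t' : Tm C n} →
            Conv R s s' → Conv R t t' → Conv R (app s t) (app s' t')
  c-pair  : ∀ {n} {s s' t t' : Tm C n} →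
            Conv R s s' → Conv R t t' → Conv R (pair s t) (pair s' t')
  c-fstc  : ∀ {n} {t t' : Tm C n} → Conv R t t' → Conv R (fst t) (fst t')
  c-sndc  : ∀ {n} {t t' : Tm C n} → Conv R t t' → Conv R (snd t) (snd t')

Tm* : ℕ → Set
Tm* = Tm ⊥

NoRule : ∀ {n} → Tm* n → Tm* n → Set
NoRule _ _ = ⊥

_≡*_ : ∀ {n} → Tm* n → Tm* n → Set
M ≡* N = Conv NoRule M N

data UConst : Set where
  U T PiH SgH starH : UConst

TmU : ℕ → Set
TmU = Tm UConst

data TRule : ∀ {n} → TmU n → TmU n → Set where
  T-Pi   : ∀ {n} {A B : TmU n} →
           TRule (app (con T) (app (app (con PiH) A) B))
                 (Pi (app (con T) A) (app (con T) (app (wk B) (var zero))))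
  T-Sg   : ∀ {n} {A B : TmU n} →
           TRule (app (con T) (app (app (con SgH) A) B))
                 (Sg (app (con T) A) (app (con T) (app (wk B) (var zero))))
  T-star : ∀ {n} → TRule {n} (app (con T) (con starH)) (con U)

_≡U_ : ∀ {n} → TmU n → TmU n → Set
M ≡U N = Conv TRule M N

reflect : ∀ {n} → Tm* n → TmU n
reflect star       = con starH
reflect (var i)    = var i
reflect (Pi A B)   = app (app (con PiH) (reflect A)) (lam (app (con T) (reflect A)) (reflect B))
reflect (Sg A B)   = app (app (con SgH) (reflect A)) (lam (app (con T) (reflect A)) (reflect B))
reflect (lam A t)  = lam (reflect A) (reflect t)
reflect (app s t)  = app (reflect s) (reflect t)
reflect (pair s t) = pair (reflect s) (reflect t)
reflect (fst t)    = fst (reflect t)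
reflect (snd t)    = snd (reflect t)
reflect (con ())

module Submission where

-- Every rule of
-- λ*-conversion is mapped to the corresponding rule of λ*U-conversion:
--   * the congruence rules for λ, application, pairs and projections go
--     through unchanged, since reflection is homomorphic on those formers;
--   * Π x:A.B and Σ x:A.B are reflected to the "coded binder"
--     k Ā (λ x:T Ā. B̄), which is a congruence in Ā and B̄ (lemma
--     codedBinder-cong);
--   * the projection rules go through since reflection commutes with pairs
--     and projections;
--   * the β-rule needs that reflection commutes with substitution,
--     reflect (s[t/x]) = reflect s [reflect t / x]  (lemma reflect-[]).

open import Defs
open import Data.Nat using (suc)
open import Data.Fin using (Fin; zero; suc)
open import Relation.Binary.PropositionalEquality
  using (_≡_; refl; sym; cong; cong₂; trans)

exts-cong : ∀ {C n m} {σ σ' : Fin n → Tm C m} →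
            (∀ i → σ i ≡ σ' i) → ∀ i → exts σ i ≡ exts σ' i
exts-cong e zero    = refl
exts-cong e (suc i) = cong wk (e i)

subst-cong : ∀ {C n m} {σ σ' : Fin n → Tm C m} →
             (∀ i → σ i ≡ σ' i) → (t : Tm C n) → subst σ t ≡ subst σ' t
subst-cong e star       = refl
subst-cong e (var i)    = e i
subst-cong e (Pi A B)   = cong₂ Pi (subst-cong e A) (subst-cong (exts-cong e) B)
subst-cong e (Sg A B)   = cong₂ Sg (subst-cong e A) (subst-cong (exts-cong e) B)
subst-cong e (lam A t)  = cong₂ lam (subst-cong e A) (subst-cong (exts-cong e) t)
subst-cong e (app s t)  = cong₂ app (subst-cong e s) (subst-cong e t)
subst-cong e (pair s t) = cong₂ pair (subst-cong e s) (subst-cong e t)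
subst-cong e (fst t)    = cong fst (subst-cong e t)
subst-cong e (snd t)    = cong snd (subst-cong e t)
subst-cong e (con c)    = refl

codedBinder : ∀ {n} → UConst → TmU n → TmU (suc n) → TmU n
codedBinder k A B = app (app (con k) A) (lam (app (con T) A) B)

codedBinder-cong : ∀ {R : ∀ {n} → TmU n → TmU n → Set} {n} (k : UConst)
                   {A A' : TmU n} {B B' : TmU (suc n)} →
                   Conv R A A' → Conv R B B' →
                   Conv R (codedBinder k A B) (codedBinder k A' B')
codedBinder-cong k A≡A' B≡B' =
  c-app (c-app c-refl A≡A') (c-lam (c-app c-refl A≡A') B≡B')

reflect-rename : ∀ {n m} (ρ : Fin n → Fin m) (t : Tm* n) →
                 reflect (rename ρ t) ≡ rename ρ (reflect t)
reflect-rename ρ star       = refl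
reflect-rename ρ (var i)    = refl
reflect-rename ρ (Pi A B)   =
  cong₂ (codedBinder PiH) (reflect-rename ρ A) (reflect-rename (ext ρ) B)
reflect-rename ρ (Sg A B)   =
  cong₂ (codedBinder SgH) (reflect-rename ρ A) (reflect-rename (ext ρ) B)
reflect-rename ρ (lam A t)  = cong₂ lam (reflect-rename ρ A) (reflect-rename (ext ρ) t)
reflect-rename ρ (app s t)  = cong₂ app (reflect-rename ρ s) (reflect-rename ρ t)
reflect-rename ρ (pair s t) = cong₂ pair (reflect-rename ρ s) (reflect-rename ρ t)
reflect-rename ρ (fst t)    = cong fst (reflect-rename ρ t)
reflect-rename ρ (snd t)    = cong snd (reflect-rename ρ t)
reflect-rename ρ (con ())

reflectSub : ∀ {n m} → (Fin n → Tm* m) → Fin n → TmU m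
reflectSub σ i = reflect (σ i)

reflect-exts : ∀ {n m} (σ : Fin n → Tm* m) →
               ∀ i → reflectSub (exts σ) i ≡ exts (reflectSub σ) i
reflect-exts σ zero    = refl
reflect-exts σ (suc i) = reflect-rename suc (σ i)

reflect-subst : ∀ {n m} (σ : Fin n → Tm* m) (t : Tm* n) →
                reflect (subst σ t) ≡ subst (reflectSub σ) (reflect t)
reflect-subst-under : ∀ {n m} (σ : Fin n → Tm* m) (B : Tm* (suc n)) →
                      reflect (subst (exts σ) B) ≡ subst (exts (reflectSub σ)) (reflect B)

reflect-subst σ star       = refl
reflect-subst σ (var i)    = refl
reflect-subst σ (Pi A B)   =
  cong₂ (codedBinder PiH) (reflect-subst σ A) (reflect-subst-under σ B)
reflect-subst σ (Sg A B)   =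
  cong₂ (codedBinder SgH) (reflect-subst σ A) (reflect-subst-under σ B)
reflect-subst σ (lam A t)  = cong₂ lam (reflect-subst σ A) (reflect-subst-under σ t)
reflect-subst σ (app s t)  = cong₂ app (reflect-subst σ s) (reflect-subst σ t)
reflect-subst σ (pair s t) = cong₂ pair (reflect-subst σ s) (reflect-subst σ t)
reflect-subst σ (fst t)    = cong fst (reflect-subst σ t)
reflect-subst σ (snd t)    = cong snd (reflect-subst σ t)
reflect-subst σ (con ())

reflect-subst-under σ B =
  trans (reflect-subst (exts σ) B) (subst-cong (reflect-exts σ) (reflect B))

reflect-[] : ∀ {n} (s : Tm* (suc n)) (t : Tm* n) →
             reflect (s [ t ]) ≡ reflect s [ reflect t ]
reflect-[] s t = trans (reflect-subst (sub0 t) s) (subst-cong reflect-sub0 (reflect s))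
  where
  reflect-sub0 : ∀ i → reflectSub (sub0 t) i ≡ sub0 (reflect t) i
  reflect-sub0 zero    = refl
  reflect-sub0 (suc i) = refl

≡⇒Conv : ∀ {C} {R : ∀ {n} → Tm C n → Tm C n → Set} {n} {u v : Tm C n} →
         u ≡ v → Conv R u v
≡⇒Conv refl = c-refl

reflect-conv : ∀ {n} {M N : Tm* n} → M ≡* N → reflect M ≡U reflect N
reflect-conv c-refl        = c-refl
reflect-conv (c-sym p)     = c-sym (reflect-conv p)
reflect-conv (c-trans p q) = c-trans (reflect-conv p) (reflect-conv q)
reflect-conv (c-beta {s = s} {t = t}) =
  c-trans c-beta (≡⇒Conv (sym (reflect-[] s t)))
reflect-conv c-fst         = c-fst
reflect-conv c-snd         = c-snd
reflect-conv (c-rule ())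
reflect-conv (c-Pi p q)    = codedBinder-cong PiH (reflect-conv p) (reflect-conv q)
reflect-conv (c-Sg p q)    = codedBinder-cong SgH (reflect-conv p) (reflect-conv q)
reflect-conv (c-lam p q)   = c-lam (reflect-conv p) (reflect-conv q)
reflect-conv (c-app p q)   = c-app (reflect-conv p) (reflect-conv q)
reflect-conv (c-pair p q)  = c-pair (reflect-conv p) (reflect-conv q)
reflect-conv (c-fstc p)    = c-fstc (reflect-conv p)
reflect-conv (c-sndc p)    = c-sndc (reflect-conv p)

mainTheorem2 : ∀ {n} (M N : Tm* n) → M ≡* N → reflect M ≡U reflect N
mainTheorem2 M N M≡N = reflect-conv M≡N
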